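{- Let $G$ be a connected graph with $V(G) = \{v_1,\ldots, v_n\}$ and let $k_1,\dots,k_n$ be positive integers. If $S$ is a gp-set of $G$ that induces a complete subgraph of $G_{\rm SR}$, and $\min\{k_i:\ v_i\in S\} \ge \max\{k_i:\ v_i\notin S\}$, then $${\rm gp}(G[K_{k_1},\ldots, K_{k_n}]) = \sum_{i:\,v_i\in S}k_i = \omega\big((G[K_{k_1},\ldots, K_{k_n}])_{\rm SR}\big)\,.$$
   Context: All graphs are finite and simple; $K_k$ is the complete graph on $k$ vertices. For a graph $G$ with $V(G)=\{v_1,\dots,v_n\}$ and pairwise disjoint graphs $H_1,\dots,H_n$, the generalized lexicographic product $G[H_1,\dots,H_n]$ has vertex set $\bigcup_{i}\{(v_i,h): h\in V(H_i)\}$, where $(v_i,h)(v_j,h')$ is an edge iff either $v_iv_j\in E(G)$ (with $h\in V(H_i)$, $h'\in V(H_j)$ arbitrary), or $i=j$ and $hh'\in E(H_i)$; i.e. each $v_i$ is replaced by $H_i$ and each edge $v_iv_j$ by all edges between $H_i$ and $H_j$. For a connected graph $X$, a set $S\subseteq V(X)$ is a general position set if no three pairwise distinct vertices of $S$ lie on a common geodesic of $X$; ${\rm gp}(X)$ is the maximum cardinality of a general position set, and a gp-set is a general position set of cardinality ${\rm gp}(X)$. A vertex $u$ is maximally distant from $v$ if every neighbor $w$ of $u$ satisfies $d_X(v,w)\le d_X(u,v)$; $u,v$ are mutually maximally distant (MMD) if each is maximally distant from the other. The strong resolving graph $X_{\rm SR}$ has vertex set $V(X)$, two vertices adjacent iff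 they are MMD in $X$. $\omega$ is the clique number. -}

module Defs where

open import Data.Nat using (ℕ; zero; suc; _+_; _≤_)
open import Data.Fin using (Fin)
open import Data.Product using (Σ; _×_; _,_; ∃)
open import Data.List using (List; length)
open import Data.List.Membership.Propositional using (_∈_)
open import Data.List.Relation.Unary.Unique.Propositional using (Unique)
open import Relation.Nullary using (¬_)
open import Relation.Binary.PropositionalEquality using (_≡_; _≢_; refl; sym)

-- A simple graph on vertex type V (loopless, undirected).  The graphs of the
-- theorem are finite because V is Fin n, resp. Σ (Fin n) (λ i → Fin (k i)).
record Graph (V : Set) : Set₁ where
  field
    Adj     : V → V → Set
    symm    : ∀ {u v} → Adj u v → Adj v u
    irrefl  : ∀ {u} → ¬ Adj u u
open Graph public

module _ {V : Set} (X : Graph V) where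

  data Walk : V → V → ℕ → Set where
    here : ∀ {u} → Walk u u 0
    step : ∀ {u w v k} → Adj X u w → Walk w v k → Walk u v (suc k)

  Connected : Set
  Connected = ∀ u v → ∃ λ k → Walk u v k

  Dist : V → V → ℕ → Set
  Dist u v k = Walk u v k × (∀ m → Walk u v m → k ≤ m)

  OnGeodesic : V → V → V → Set
  OnGeodesic u w v =
    Σ ℕ λ a → Σ ℕ λ b → Dist u w a × Dist w v b × Dist u v (a + b)

  -- Finite vertex sets are duplicate-free lists; cardinality = length.
  -- general position: no three distinct vertices of S on a common geodesic
  GenPos : List V → Set
  GenPos S = ∀ u v w → u ∈ S → v ∈ S → w ∈ S →
    u ≢ v → v ≢ w → u ≢ w → ¬ OnGeodesic u w v

  IsGpSet : List V → Set
  IsGpSet S = Unique S × GenPos S ×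
    (∀ T → Unique T → GenPos T → length T ≤ length S)

  GpNumber : ℕ → Set
  GpNumber m = (Σ (List V) λ S → Unique S × GenPos S × length S ≡ m) ×
    (∀ T → Unique T → GenPos T → length T ≤ m)

  MaxDistant : V → V → Set
  MaxDistant u v = ∀ w → Adj X u w → ∀ a b → Dist v w a → Dist u v b → a ≤ b

  MMD : V → V → Set
  MMD u v = MaxDistant u v × MaxDistant v u

  IsClique : List V → Set
  IsClique S = ∀ u v → u ∈ S → v ∈ S → u ≢ v → Adj X u v

  CliqueNumber : ℕ → Set
  CliqueNumber m = (Σ (List V) λ S → Unique S × IsClique S × length S ≡ m) ×
    (∀ T → Unique T → IsClique T → length T ≤ m)

SR : {V : Set} → Graph V → Graph V
SR X = record
  { Adj = λ u v → u ≢ v × MMD X u v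
  ; symm = λ { (ne , m1 , m2) → (λ e → ne (sym e)) , m2 , m1 }
  ; irrefl = λ { (ne , _) → ne refl }
  }

K : (k : ℕ) → Graph (Fin k)
K k = record
  { Adj = λ a b → a ≢ b
  ; symm = λ ne e → ne (sym e)
  ; irrefl = λ ne → ne refl
  }

module _ {V : Set} {W : V → Set} (G : Graph V) (H : (v : V) → Graph (W v)) where

  data LexAdj : Σ V W → Σ V W → Set where
    outer : ∀ {i j h h'} → Adj G i j → LexAdj (i , h) (j , h')
    inner : ∀ {i h h'} → Adj (H i) h h' → LexAdj (i , h) (i , h')

  lexSymm : ∀ {x y} → LexAdj x y → LexAdj y x
  lexSymm (outer a) = outer (symm G a)
  lexSymm (inner {i} a) = inner (symm (H i) a)

  lexIrrefl : ∀ {x} → ¬ LexAdj x x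
  lexIrrefl (outer a) = irrefl G a
  lexIrrefl (inner {i} a) = irrefl (H i) a

  Lex : Graph (Σ V W)
  Lex = record { Adj = LexAdj ; symm = lexSymm ; irrefl = lexIrrefl }

LexK : {n : ℕ} → Graph (Fin n) → (k : Fin n → ℕ) → Graph (Σ (Fin n) (λ i → Fin (k i)))
LexK G k = Lex G (λ i → K (k i))

-- Distances in G[K_{k_1},…,K_{k_n}] between different fibres are those of G,
-- and two vertices of one fibre are adjacent twins.  Hence a general position
-- set T of the product projects onto a general position set P of G, and
-- |T| ≤ Σ_{i ∈ P} k_i.  Since |P| ≤ |S| and the weights on S dominate those
-- off S, exchanging the elements of P one by one for elements of S gives
-- Σ_{i ∈ P} k_i ≤ Σ_{i ∈ S} k_i.  Conversely, the union of the fibres over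
-- S is a clique of the strong resolving graph of the product, and such a
-- clique is always in general position; this also bounds the clique number.
module Submission where

open import Defs
open import Data.Nat using (ℕ; zero; suc; _+_; _≤_; z≤n; s≤s)
open import Data.Nat.Properties
  using (≤-refl; ≤-trans; ≤-antisym; ≤-pred; <⇒≱; 1+n≰n; m≤n⇒m≤1+n; +-suc; +-mono-≤; +-cancelʳ-≤;
         module ≤-Reasoning)
open import Data.Nat.ListAction using (sum)
open import Data.Nat.ListAction.Properties using (sum-↭)
open import Data.Fin using (Fin; fromℕ<; _≟_)
open import Data.Product using (Σ; ∃; _×_; _,_; proj₁; proj₂)
open import Data.List using (List; []; _∷_; _++_; map; length; tabulate; concatMap; deduplicate)
open import Data.List.Properties using (length-++; length-tabulate)
open import Data.List.Relation.Unary.Any as Any using (here; there; any?)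
open import Data.List.Relation.Unary.All.Properties using (¬Any⇒All¬)
import Data.List.Relation.Unary.All as All
open import Data.List.Relation.Unary.AllPairs using ([]; _∷_)
open import Data.List.Relation.Unary.Unique.Propositional using (Unique)
import Data.List.Relation.Unary.Unique.Propositional.Properties as Unique
open import Data.List.Relation.Unary.Unique.DecPropositional.Properties using (deduplicate-!)
open import Data.List.Relation.Binary.Permutation.Propositional using (_↭_; ↭-sym; ↭⇒↭ₛ)
open import Data.List.Relation.Binary.Permutation.Propositional.Properties
  using (∈-resp-↭; ↭-length; shift; map⁺)
import Data.List.Relation.Binary.Permutation.Setoid.Properties as Permutationₛ
open import Data.List.Membership.Propositional using (_∈_; _∉_; find)
open import Data.List.Membership.Propositional.Properties
  using (∈-∃++; ∈-map⁺; ∈-map⁻; ∈-tabulate⁺; ∈-tabulate⁻; ∈-concatMap⁺; ∈-concatMap⁻;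
         ∈-deduplicate⁺; ∈-deduplicate⁻)
import Data.List.Membership.DecPropositional as DecMembership
open import Function using (_∘_)
open import Relation.Nullary using (¬_; yes; no; ¬?; contradiction; decidable-stable)
open import Relation.Binary.Definitions using (DecidableEquality)
open import Relation.Binary.PropositionalEquality
  using (_≡_; _≢_; refl; sym; trans; cong; cong₂; subst; setoid)

module _ {A : Set} where

  ∈⇒↭∷ : ∀ {x : A} {xs} → x ∈ xs → ∃ λ ys → xs ↭ x ∷ ys
  ∈⇒↭∷ x∈xs with as , bs , refl ← ∈-∃++ x∈xs = as ++ bs , shift _ as bs

  Unique-resp-↭ : ∀ {xs ys : List A} → xs ↭ ys → Unique xs → Unique ys
  Unique-resp-↭ = Permutationₛ.Unique-resp-↭ (setoid A) ∘ ↭⇒↭ₛ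

  ∈-↭∷⁻ : ∀ {x y : A} {xs ys} → xs ↭ x ∷ ys → y ∈ xs → y ≢ x → y ∈ ys
  ∈-↭∷⁻ σ y∈xs y≢x with ∈-resp-↭ σ y∈xs
  ... | here y≡x = contradiction y≡x y≢x
  ... | there y∈ys = y∈ys

  Unique-⊆⇒length≤ : ∀ {xs ys : List A} → Unique xs → (∀ {x} → x ∈ xs → x ∈ ys) →
                     length xs ≤ length ys
  Unique-⊆⇒length≤ {[]} [] _ = z≤n
  Unique-⊆⇒length≤ {x ∷ xs} {ys} (x∉xs ∷ xs!) xs⊆ys
    with ys′ , σ ← ∈⇒↭∷ (xs⊆ys (here refl)) =
    subst (suc (length xs) ≤_) (sym (↭-length σ))
      (s≤s (Unique-⊆⇒length≤ xs! λ y∈xs →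
        ∈-↭∷⁻ σ (xs⊆ys (there y∈xs)) (All.lookup x∉xs y∈xs ∘ sym)))

  Dominates : (A → ℕ) → List A → List A → Set
  Dominates f S P = ∀ {i j} → i ∈ S → j ∈ P → j ∉ S → f j ≤ f i

module _ {A : Set} (_≟ᴬ_ : DecidableEquality A) (f : A → ℕ) where

  open DecMembership _≟ᴬ_ using (_∈?_)

  exchange-partner : ∀ {p} {P S : List A} → Unique (p ∷ P) → Unique S →
                     length (p ∷ P) ≤ length S → Dominates f S (p ∷ P) →
                     ∃ λ s → s ∈ S × s ∉ P × f p ≤ f s
  exchange-partner {p} {P} {S} (p∉P ∷ _) S! P<S dom with p ∈? S
  ... | yes p∈S = p , p∈S , (λ p∈P → All.lookup p∉P p∈P refl) , ≤-refl
  ... | no p∉S with any? (λ s → ¬? (s ∈? P)) S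
  ...   | yes ∃s∉P with s , s∈S , s∉P ← find ∃s∉P = s , s∈S , s∉P , dom s∈S (here refl) p∉S
  ...   | no ∄s∉P = contradiction (Unique-⊆⇒length≤ S! S⊆P) (<⇒≱ P<S)
    where
      S⊆P : ∀ {s} → s ∈ S → s ∈ P
      S⊆P s∈S = decidable-stable (_ ∈? P) (All.lookup (¬Any⇒All¬ S ∄s∉P) s∈S)

  Dominates⇒sum≤ : ∀ {P S : List A} → Unique P → Unique S → length P ≤ length S →
                   Dominates f S P → sum (map f P) ≤ sum (map f S)
  Dominates⇒sum≤ {[]} _ _ _ _ = z≤n
  Dominates⇒sum≤ {p ∷ P} {S} pP!@(_ ∷ P!) S! P≤S dom
    with s , s∈S , s∉P , fp≤fs ← exchange-partner pP! S! P≤S dom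
    with S′ , σ ← ∈⇒↭∷ s∈S
    with _ ∷ S′! ← Unique-resp-↭ σ S! =
    subst (f p + sum (map f P) ≤_) (sym (sum-↭ (map⁺ f σ)))
      (+-mono-≤ fp≤fs (Dominates⇒sum≤ P! S′! P≤S′ dom′))
    where
      P≤S′ : length P ≤ length S′
      P≤S′ = ≤-pred (subst (suc (length P) ≤_) (↭-length σ) P≤S)
      dom′ : Dominates f S′ P
      dom′ i∈S′ j∈P j∉S′ = dom (∈-resp-↭ (↭-sym σ) (there i∈S′)) (there j∈P)
        (λ j∈S → j∉S′ (∈-↭∷⁻ σ j∈S (λ j≡s → s∉P (subst (_∈ P) j≡s j∈P))))

module _ {V : Set} (X : Graph V) where

  snocʷ : ∀ {u w v a} → Walk X u w a → Adj X w v → Walk X u v (suc a)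
  snocʷ here wv = step wv here
  snocʷ (step e r) wv = step e (snocʷ r wv)

  _++ʷ_ : ∀ {u w v a b} → Walk X u w a → Walk X w v b → Walk X u v (a + b)
  here ++ʷ r = r
  step e p ++ʷ r = step e (p ++ʷ r)

  reverseʷ : ∀ {u v a} → Walk X u v a → Walk X v u a
  reverseʷ here = here
  reverseʷ (step e r) = snocʷ (reverseʷ r) (symm X e)

  Walk0⇒≡ : ∀ {u v} → Walk X u v 0 → u ≡ v
  Walk0⇒≡ here = refl

  Dist-sym : ∀ {u v d} → Dist X u v d → Dist X v u d
  Dist-sym (uv , min) = reverseʷ uv , λ m vu → min m (reverseʷ vu)

  ≢⇒Dist-pos : ∀ {u v d} → u ≢ v → Dist X u v d → 1 ≤ d
  ≢⇒Dist-pos {d = zero} u≢v (uv , _) = contradiction (Walk0⇒≡ uv) u≢v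
  ≢⇒Dist-pos {d = suc d} _ _ = s≤s z≤n

  MaxDistant⇒¬OnGeodesic : ∀ {u w v} → w ≢ v → MaxDistant X w u → ¬ OnGeodesic X u w v
  MaxDistant⇒¬OnGeodesic w≢v _ (_ , _ , _ , (here , _) , _) = w≢v refl
  MaxDistant⇒¬OnGeodesic {u} _ w-max
    (a , suc b , (uw , uw-min) , (step {w = w′} ww′ w′v , _) , (_ , uv-min)) =
    1+n≰n (w-max w′ ww′ (suc a) a (snocʷ uw ww′ , farther) (Dist-sym (uw , uw-min)))
    where
      -- a u,w′-walk continues along w′v to a u,v-walk, of length at least a + suc b
      farther : ∀ m → Walk X u w′ m → suc a ≤ m
      farther m uw′ = +-cancelʳ-≤ b (suc a) m
        (subst (_≤ m + b) (+-suc a b) (uv-min (m + b) (uw′ ++ʷ w′v)))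

  SR-clique⇒GenPos : ∀ {S} → IsClique (SR X) S → GenPos X S
  SR-clique⇒GenPos clique u v w u∈S v∈S w∈S _ v≢w u≢w =
    MaxDistant⇒¬OnGeodesic (v≢w ∘ sym) (proj₁ (proj₂ (clique w u w∈S u∈S (u≢w ∘ sym))))

  GenPos-⊆ : ∀ {S T} → (∀ {x} → x ∈ T → x ∈ S) → GenPos X S → GenPos X T
  GenPos-⊆ T⊆S S-gp u v w u∈T v∈T w∈T = S-gp u v w (T⊆S u∈T) (T⊆S v∈T) (T⊆S w∈T)

module Lex-Properties {V : Set} {W : V → Set} (G : Graph V) (H : (v : V) → Graph (W v))
                      (point : (v : V) → W v) where

  private
    L : Graph (Σ V W)
    L = Lex G H

  project : ∀ {x y d} → Walk L x y d → ∃ λ m → m ≤ d × Walk G (proj₁ x) (proj₁ y) m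
  project here = 0 , z≤n , here
  project (step (outer e) r) with m , m≤d , w ← project r = suc m , s≤s m≤d , step e w
  project (step (inner _) r) with m , m≤d , w ← project r = m , m≤n⇒m≤1+n m≤d , w

  lift : ∀ {i j d} → Walk G i j (suc d) → ∀ h h′ → Walk L (i , h) (j , h′) (suc d)
  lift (step e here) _ _ = step (outer e) here
  lift (step {w = w} e r@(step _ _)) _ h′ = step (outer e) (lift r (point w) h′)

  lift≢ : ∀ {x y : Σ V W} {m} → proj₁ x ≢ proj₁ y → Walk G (proj₁ x) (proj₁ y) m → Walk L x y m
  lift≢ {m = zero} x≢y w = contradiction (Walk0⇒≡ G w) x≢y
  lift≢ {x} {y} {m = suc m} _ w = lift w (proj₂ x) (proj₂ y)

  Dist-Lex⇒Dist : ∀ {x y d} → proj₁ x ≢ proj₁ y → Dist L x y d → Dist G (proj₁ x) (proj₁ y) d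
  Dist-Lex⇒Dist x≢y (xy , min) with m , m≤d , w ← project xy =
    subst (Walk G _ _) (≤-antisym m≤d (min m (lift≢ x≢y w))) w ,
    λ m′ w′ → min m′ (lift≢ x≢y w′)

  Dist⇒Dist-Lex : ∀ {x y d} → proj₁ x ≢ proj₁ y → Dist G (proj₁ x) (proj₁ y) d → Dist L x y d
  Dist⇒Dist-Lex x≢y (w , min) =
    lift≢ x≢y w , λ m xy → let (m′ , m′≤m , w′) = project xy in ≤-trans (min m′ w′) m′≤m

  GenPos-proj₁ : ∀ {T} → GenPos L T → GenPos G (map proj₁ T)
  GenPos-proj₁ T-gp i j l i∈ j∈ l∈ i≢j j≢l i≢l (a , b , il , lj , ij)
    with x , x∈T , refl ← ∈-map⁻ proj₁ i∈
       | y , y∈T , refl ← ∈-map⁻ proj₁ j∈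
       | z , z∈T , refl ← ∈-map⁻ proj₁ l∈ =
    T-gp x y z x∈T y∈T z∈T (i≢j ∘ cong proj₁) (j≢l ∘ cong proj₁) (i≢l ∘ cong proj₁)
      (a , b , Dist⇒Dist-Lex i≢l il , Dist⇒Dist-Lex (j≢l ∘ sym) lj , Dist⇒Dist-Lex i≢j ij)

module LexK-Properties {n : ℕ} (G : Graph (Fin n)) (k : Fin n → ℕ) (k-pos : ∀ i → 1 ≤ k i) where

  private
    Vertex : Set
    Vertex = Σ (Fin n) (λ i → Fin (k i))

    L : Graph Vertex
    L = LexK G k

    point : ∀ i → Fin (k i)
    point i = fromℕ< (k-pos i)

  open Lex-Properties G (λ i → K (k i)) point

  fibre-Dist≤1 : ∀ {i} {h h′ : Fin (k i)} {a} → Dist L (i , h) (i , h′) a → a ≤ 1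
  fibre-Dist≤1 {h = h} {h′} (_ , min) with h ≟ h′
  ... | yes refl = m≤n⇒m≤1+n (min 0 here)
  ... | no h≢h′ = min 1 (step (inner h≢h′) here)

  twin-neighbour-Dist≤1 : ∀ {i} {h g : Fin (k i)} {w a} → Adj L (i , h) w →
                          Dist L (i , g) w a → a ≤ 1
  twin-neighbour-Dist≤1 (outer e) (_ , min) = min 1 (step (outer e) here)
  twin-neighbour-Dist≤1 (inner _) gw = fibre-Dist≤1 gw

  MaxDistant-lift : ∀ {u v} → u ≢ v →
                    (proj₁ u ≢ proj₁ v → MaxDistant G (proj₁ u) (proj₁ v)) → MaxDistant L u v
  MaxDistant-lift {i , h} {j , g} u≢v G-max w uw a b vw uv with i ≟ j
  ... | yes refl = ≤-trans (twin-neighbour-Dist≤1 uw vw) (≢⇒Dist-pos L u≢v uv)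
  MaxDistant-lift {i , h} {j , g} u≢v G-max (i , h′) (inner _) a b vw uv | no i≢j =
    proj₂ (Dist-Lex⇒Dist (i≢j ∘ sym) vw) b (proj₁ (Dist-sym G (Dist-Lex⇒Dist i≢j uv)))
  MaxDistant-lift {i , h} {j , g} u≢v G-max (l , h′) (outer e) a b vw uv | no i≢j with l ≟ j
  ... | yes refl = ≤-trans (fibre-Dist≤1 vw) (≢⇒Dist-pos L u≢v uv)
  ... | no l≢j = G-max i≢j l e a b (Dist-Lex⇒Dist (l≢j ∘ sym) vw) (Dist-Lex⇒Dist i≢j uv)

  fibre : (i : Fin n) → List Vertex
  fibre i = tabulate (i ,_)

  fibres : List (Fin n) → List Vertex
  fibres = concatMap fibre

  length-fibres : ∀ P → length (fibres P) ≡ sum (map k P)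
  length-fibres [] = refl
  length-fibres (i ∷ P) = trans (length-++ (fibre i))
    (cong₂ _+_ (length-tabulate (i ,_)) (length-fibres P))

  ∈-fibre⁻ : ∀ {i x} → x ∈ fibre i → proj₁ x ≡ i
  ∈-fibre⁻ x∈ = cong proj₁ (proj₂ (∈-tabulate⁻ x∈))

  ∈-fibres⁺ : ∀ {x P} → proj₁ x ∈ P → x ∈ fibres P
  ∈-fibres⁺ {_ , h} = ∈-concatMap⁺ fibre ∘ Any.map (λ { refl → ∈-tabulate⁺ h })

  ∈-fibres⁻ : ∀ {x P} → x ∈ fibres P → proj₁ x ∈ P
  ∈-fibres⁻ = Any.map ∈-fibre⁻ ∘ ∈-concatMap⁻ fibre

  fibres-Unique : ∀ {P} → Unique P → Unique (fibres P)
  fibres-Unique [] = []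
  fibres-Unique {i ∷ P} (i∉P ∷ P!) =
    Unique.++⁺ (Unique.tabulate⁺ λ { refl → refl }) (fibres-Unique P!) disjoint
    where
      disjoint : ∀ {x} → ¬ (x ∈ fibre i × x ∈ fibres P)
      disjoint (x∈i , x∈P) = All.lookup i∉P (∈-fibres⁻ x∈P) (sym (∈-fibre⁻ x∈i))

  fibres-SR-clique : ∀ {S} → IsClique (SR G) S → IsClique (SR L) (fibres S)
  fibres-SR-clique {S} S-clique u v u∈ v∈ u≢v =
    u≢v , MaxDistant-lift u≢v (G-max u∈ v∈) , MaxDistant-lift (u≢v ∘ sym) (G-max v∈ u∈)
    where
      G-max : ∀ {u v} → u ∈ fibres S → v ∈ fibres S → proj₁ u ≢ proj₁ v →
              MaxDistant G (proj₁ u) (proj₁ v)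
      G-max u∈ v∈ u≢v = proj₁ (proj₂ (S-clique _ _ (∈-fibres⁻ u∈) (∈-fibres⁻ v∈) u≢v))

  GenPos-length≤ : ∀ {S} → IsGpSet G S → (∀ i j → i ∈ S → j ∉ S → k j ≤ k i) →
                   ∀ T → Unique T → GenPos L T → length T ≤ sum (map k S)
  GenPos-length≤ {S} (S! , _ , S-max) dom T T! T-gp = begin
    length T              ≤⟨ Unique-⊆⇒length≤ T! (∈-fibres⁺ ∘ ∈-deduplicate⁺ _≟_ ∘ ∈-map⁺ proj₁) ⟩
    length (fibres P)     ≡⟨ length-fibres P ⟩
    sum (map k P)         ≤⟨ Dominates⇒sum≤ _≟_ k P! S! (S-max P P! P-gp) (λ i∈S _ → dom _ _ i∈S) ⟩
    sum (map k S)         ∎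
    where
      open ≤-Reasoning
      P : List (Fin n)
      P = deduplicate _≟_ (map proj₁ T)
      P! : Unique P
      P! = deduplicate-! _≟_ (map proj₁ T)
      P-gp : GenPos G P
      P-gp = GenPos-⊆ G (∈-deduplicate⁻ _≟_ (map proj₁ T)) (GenPos-proj₁ T-gp)

theorem5p1 : (n : ℕ) (G : Graph (Fin n)) → Connected G →
    (k : Fin n → ℕ) → (∀ i → 1 ≤ k i) →
    (S : List (Fin n)) → IsGpSet G S → IsClique (SR G) S →
    (∀ i j → i ∈ S → j ∉ S → k j ≤ k i) →
    GpNumber (LexK G k) (sum (map k S)) × CliqueNumber (SR (LexK G k)) (sum (map k S))
theorem5p1 n G _ k k-pos S S-gpset@(S! , _) S-clique dom =
  ((fibres S , fibres-Unique S! , SR-clique⇒GenPos _ S-fibres-clique , length-fibres S) , upper) ,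
  ((fibres S , fibres-Unique S! , S-fibres-clique , length-fibres S) ,
   λ T T! T-clique → upper T T! (SR-clique⇒GenPos _ T-clique))
  where
    open LexK-Properties G k k-pos
    S-fibres-clique : IsClique (SR (LexK G k)) (fibres S)
    S-fibres-clique = fibres-SR-clique S-clique
    upper : ∀ T → Unique T → GenPos (LexK G k) T → length T ≤ sum (map k S)
    upper = GenPos-length≤ S-gpset dom
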